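{- Every graph $G$ that is both fork-free and co-cricket-free satisfies $\chi(G)\le \omega(G)^2$.
   Context: Graphs are finite and simple. A graph $G$ is $H$-free if no induced subgraph of $G$ is isomorphic to $H$. The fork is the graph obtained from $K_{1,3}$ by subdividing one edge once. The diamond is $K_4$ minus an edge; the co-cricket is the disjoint union of a diamond and a single vertex. $\chi(G)$ is the chromatic number and $\omega(G)$ the clique number of $G$. -}

module Defs where

open import Data.Nat using (ℕ; _≤_; _*_)
open import Data.Fin using (Fin; zero; suc)
open import Data.Bool using (Bool; true; false)
open import Data.Product using (Σ; _×_; ∃)
open import Relation.Binary.PropositionalEquality using (_≡_; _≢_)
open import Relation.Nullary using (¬_)
open import Function.Definitions using (Injective)

record Graph (n : ℕ) : Set where
  field
    adj   : Fin n → Fin n → Bool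
    sym   : ∀ u v → adj u v ≡ adj v u
    irrefl : ∀ v → adj v v ≡ false
open Graph public

InducedSub : ∀ {k n} → Graph k → Graph n → Set
InducedSub {k} {n} H G =
  Σ (Fin k → Fin n) λ f → Injective _≡_ _≡_ f × (∀ i j → adj G (f i) (f j) ≡ adj H i j)

_-free : ∀ {k n} → Graph k → Graph n → Set
(H -free) G = ¬ InducedSub H G

-- Fork: K_{1,3} with centre 0 and leaves 1,2,3, edge 0-3 subdivided by 4.
-- Edges: 01, 02, 04, 43.
forkAdj : Fin 5 → Fin 5 → Bool
forkAdj zero (suc zero) = true
forkAdj zero (suc (suc zero)) = true
forkAdj zero (suc (suc (suc (suc zero)))) = true
forkAdj (suc zero) zero = true
forkAdj (suc (suc zero)) zero = true
forkAdj (suc (suc (suc (suc zero)))) zero = true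
forkAdj (suc (suc (suc zero))) (suc (suc (suc (suc zero)))) = true
forkAdj (suc (suc (suc (suc zero)))) (suc (suc (suc zero))) = true
forkAdj _ _ = false

-- Co-cricket: diamond on 0,1,2,3 (all pairs except 2-3) plus isolated vertex 4.
-- Edges: 01, 02, 03, 12, 13.
cocricketAdj : Fin 5 → Fin 5 → Bool
cocricketAdj zero (suc zero) = true
cocricketAdj zero (suc (suc zero)) = true
cocricketAdj zero (suc (suc (suc zero))) = true
cocricketAdj (suc zero) (suc (suc zero)) = true
cocricketAdj (suc zero) (suc (suc (suc zero))) = true
cocricketAdj (suc zero) zero = true
cocricketAdj (suc (suc zero)) zero = true
cocricketAdj (suc (suc (suc zero))) zero = true
cocricketAdj (suc (suc zero)) (suc zero) = true
cocricketAdj (suc (suc (suc zero))) (suc zero) = true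
cocricketAdj _ _ = false

forkSym : ∀ u v → forkAdj u v ≡ forkAdj v u
forkSym zero zero = _≡_.refl
forkSym zero (suc zero) = _≡_.refl
forkSym zero (suc (suc zero)) = _≡_.refl
forkSym zero (suc (suc (suc zero))) = _≡_.refl
forkSym zero (suc (suc (suc (suc zero)))) = _≡_.refl
forkSym (suc zero) zero = _≡_.refl
forkSym (suc zero) (suc zero) = _≡_.refl
forkSym (suc zero) (suc (suc zero)) = _≡_.refl
forkSym (suc zero) (suc (suc (suc zero))) = _≡_.refl
forkSym (suc zero) (suc (suc (suc (suc zero)))) = _≡_.refl
forkSym (suc (suc zero)) zero = _≡_.refl
forkSym (suc (suc zero)) (suc zero) = _≡_.refl
forkSym (suc (suc zero)) (suc (suc zero)) = _≡_.refl
forkSym (suc (suc zero)) (suc (suc (suc zero))) = _≡_.refl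
forkSym (suc (suc zero)) (suc (suc (suc (suc zero)))) = _≡_.refl
forkSym (suc (suc (suc zero))) zero = _≡_.refl
forkSym (suc (suc (suc zero))) (suc zero) = _≡_.refl
forkSym (suc (suc (suc zero))) (suc (suc zero)) = _≡_.refl
forkSym (suc (suc (suc zero))) (suc (suc (suc zero))) = _≡_.refl
forkSym (suc (suc (suc zero))) (suc (suc (suc (suc zero)))) = _≡_.refl
forkSym (suc (suc (suc (suc zero)))) zero = _≡_.refl
forkSym (suc (suc (suc (suc zero)))) (suc zero) = _≡_.refl
forkSym (suc (suc (suc (suc zero)))) (suc (suc zero)) = _≡_.refl
forkSym (suc (suc (suc (suc zero)))) (suc (suc (suc zero))) = _≡_.refl
forkSym (suc (suc (suc (suc zero)))) (suc (suc (suc (suc zero)))) = _≡_.refl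

cocricketSym : ∀ u v → cocricketAdj u v ≡ cocricketAdj v u
cocricketSym zero zero = _≡_.refl
cocricketSym zero (suc zero) = _≡_.refl
cocricketSym zero (suc (suc zero)) = _≡_.refl
cocricketSym zero (suc (suc (suc zero))) = _≡_.refl
cocricketSym zero (suc (suc (suc (suc zero)))) = _≡_.refl
cocricketSym (suc zero) zero = _≡_.refl
cocricketSym (suc zero) (suc zero) = _≡_.refl
cocricketSym (suc zero) (suc (suc zero)) = _≡_.refl
cocricketSym (suc zero) (suc (suc (suc zero))) = _≡_.refl
cocricketSym (suc zero) (suc (suc (suc (suc zero)))) = _≡_.refl
cocricketSym (suc (suc zero)) zero = _≡_.refl
cocricketSym (suc (suc zero)) (suc zero) = _≡_.refl
cocricketSym (suc (suc zero)) (suc (suc zero)) = _≡_.refl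
cocricketSym (suc (suc zero)) (suc (suc (suc zero))) = _≡_.refl
cocricketSym (suc (suc zero)) (suc (suc (suc (suc zero)))) = _≡_.refl
cocricketSym (suc (suc (suc zero))) zero = _≡_.refl
cocricketSym (suc (suc (suc zero))) (suc zero) = _≡_.refl
cocricketSym (suc (suc (suc zero))) (suc (suc zero)) = _≡_.refl
cocricketSym (suc (suc (suc zero))) (suc (suc (suc zero))) = _≡_.refl
cocricketSym (suc (suc (suc zero))) (suc (suc (suc (suc zero)))) = _≡_.refl
cocricketSym (suc (suc (suc (suc zero)))) zero = _≡_.refl
cocricketSym (suc (suc (suc (suc zero)))) (suc zero) = _≡_.refl
cocricketSym (suc (suc (suc (suc zero)))) (suc (suc zero)) = _≡_.refl
cocricketSym (suc (suc (suc (suc zero)))) (suc (suc (suc zero))) = _≡_.refl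
cocricketSym (suc (suc (suc (suc zero)))) (suc (suc (suc (suc zero)))) = _≡_.refl

forkIrr : ∀ v → forkAdj v v ≡ false
forkIrr zero = _≡_.refl
forkIrr (suc zero) = _≡_.refl
forkIrr (suc (suc zero)) = _≡_.refl
forkIrr (suc (suc (suc zero))) = _≡_.refl
forkIrr (suc (suc (suc (suc zero)))) = _≡_.refl

cocricketIrr : ∀ v → cocricketAdj v v ≡ false
cocricketIrr zero = _≡_.refl
cocricketIrr (suc zero) = _≡_.refl
cocricketIrr (suc (suc zero)) = _≡_.refl
cocricketIrr (suc (suc (suc zero))) = _≡_.refl
cocricketIrr (suc (suc (suc (suc zero)))) = _≡_.refl

fork : Graph 5
fork = record { adj = forkAdj ; sym = forkSym ; irrefl = forkIrr }

cocricket : Graph 5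
cocricket = record { adj = cocricketAdj ; sym = cocricketSym ; irrefl = cocricketIrr }

HasClique : ∀ {n} → Graph n → ℕ → Set
HasClique {n} G k =
  Σ (Fin k → Fin n) λ f → Injective _≡_ _≡_ f × (∀ i j → i ≢ j → adj G (f i) (f j) ≡ true)

IsCliqueNumber : ∀ {n} → Graph n → ℕ → Set
IsCliqueNumber G ω = HasClique G ω × (∀ k → HasClique G k → k ≤ ω)

ProperColouring : ∀ {n} → Graph n → ℕ → Set
ProperColouring {n} G c =
  Σ (Fin n → Fin c) λ col → ∀ u v → adj G u v ≡ true → col u ≢ col v

IsChromaticNumber : ∀ {n} → Graph n → ℕ → Set
IsChromaticNumber G χ = ProperColouring G χ × (∀ c → ProperColouring G c → χ ≤ c)

-- For a vertex v, the neighbourhood of v has clique number at most ω - 1 and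
-- is coloured with (ω - 1)² colours by induction; the non-neighbourhood is diamond-free, since a
-- diamond there together with v is a co-cricket, and (fork, diamond)-free graphs with clique
-- number at most ω are (2ω - 1)-colourable; finally (ω - 1)² + (2ω - 1) = ω².
--
-- The (2ω - 1)-colouring is by induction on the number of vertices.  A vertex of degree at most
-- 2ω - 2 is coloured last.  Otherwise, diamond-freeness splits every neighbourhood into cliques
-- of size at most ω - 1, so every vertex has three pairwise non-adjacent neighbours; forks then
-- rule out triangles, and the vertices within distance 3 of any vertex v form a union of
-- components that is bipartite (v and the vertices at distance 2 against their neighbours).

module Submission where

open import Level using (0ℓ)
open import Data.Bool using (true; false)
open import Data.Bool.Properties using (¬-not) renaming (_≟_ to _≟ᵇ_)
open import Data.Empty using (⊥; ⊥-elim)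
open import Data.Fin using (Fin; zero; suc; join; splitAt; inject≤) renaming (_≟_ to _≟ᶠ_)
open import Data.Fin.Patterns using (0F; 1F; 2F; 3F; 4F)
open import Data.Fin.Properties using (any?; all?; ¬∀⟶∃¬; pigeonhole; splitAt-join; inject≤-injective)
  renaming (<⇒≢ to <⇒≢ᶠ)
open import Data.List using ([]; _∷_; length; filter; lookup; allFin)
open import Data.List.Membership.Propositional using (_∈_)
open import Data.List.Membership.Propositional.Properties using (∈-filter⁺; ∈-allFin; ∈-lookup)
open import Data.List.Relation.Unary.All as All using (All; []; _∷_)
open import Data.List.Relation.Unary.All.Properties using (all-filter)
open import Data.List.Relation.Unary.Any using (here; there; index)
open import Data.List.Relation.Unary.Any.Properties using (lookup-index)
open import Data.List.Relation.Unary.AllPairs using (AllPairs; []; _∷_)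
import Data.List.Relation.Unary.AllPairs.Properties as AllPairsₚ
open import Data.List.Relation.Unary.Unique.Propositional.Properties using (allFin⁺)
import Data.List.Relation.Binary.Sublist.Propositional as Sublist
import Data.List.Relation.Binary.Sublist.Propositional.Properties as Sublistₚ
open import Data.Nat using (ℕ; zero; suc; _+_; _*_; _≤_; _<_; z≤n; s≤s; _≤?_)
open import Data.Nat.Properties
  using (≤-refl; ≤-trans; ≤-reflexive; ≤-pred; <-irrefl; <⇒≱; ≰⇒>; ≤-<-trans;
         +-mono-≤; +-monoʳ-≤; +-suc; n≤1+n; m≤m+n)
open import Data.Nat.Induction using (<-rec)
open import Data.Nat.Tactic.RingSolver using (solve-∀)
open import Data.Product using (∃; ∃₂; _×_; _,_; proj₁; proj₂)
open import Data.Sum using (_⊎_; inj₁; inj₂; [_,_])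
import Data.Sum as Sum
open import Data.Sum.Properties using (inj₁-injective; inj₂-injective)
open import Function using (_∘_)
open import Relation.Binary using (Rel; Symmetric)
open import Relation.Binary.PropositionalEquality using (_≡_; _≢_; refl; sym; trans; cong; subst; ≢-sym)
open import Relation.Nullary using (¬_; Dec; yes; no; does; ¬?)
open import Relation.Nullary.Decidable using (from-yes; _×-dec_; _⊎-dec_; _→-dec_)
open import Relation.Unary using (Pred; Decidable; _⊆_; _∩_; _∪_; ∁; U)
open import Relation.Unary.Properties using (_∩?_; _∪?_; ∁?; U?)

open import Defs renaming (sym to adj-sym; irrefl to adj-irrefl)

module _ {a p} {A : Set a} {P : Pred A p} (P? : Decidable P) where

  filter-length-∷ : ∀ {x} xs → length (filter P? xs) ≤ length (filter P? (x ∷ xs))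
  filter-length-∷ {x} xs with does (P? x)
  ... | true  = n≤1+n _
  ... | false = ≤-refl

module _ {a p q} {A : Set a} {P : Pred A p} {Q : Pred A q} (P? : Decidable P) (Q? : Decidable Q) where

  filter-length-mono : P ⊆ Q → ∀ xs → length (filter P? xs) ≤ length (filter Q? xs)
  filter-length-mono P⊆Q xs =
    Sublistₚ.length-mono-≤ (Sublistₚ.filter⁺ P? Q? (λ { refl → P⊆Q }) (Sublist.⊆-refl {x = xs}))

  filter-length-< : ∀ {x xs} → P ⊆ Q → Q x → ¬ P x → x ∈ xs →
                    length (filter P? xs) < length (filter Q? xs)
  filter-length-< {x} {_ ∷ xs} P⊆Q qx ¬px (here refl) with P? x | Q? x
  ... | yes px | _      = ⊥-elim (¬px px)
  ... | no _   | yes _  = s≤s (filter-length-mono P⊆Q xs)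
  ... | no _   | no ¬qx = ⊥-elim (¬qx qx)
  filter-length-< {_} {y ∷ _} P⊆Q qx ¬px (there x∈xs)
    with ih ← filter-length-< P⊆Q qx ¬px x∈xs | P? y | Q? y
  ... | yes _  | yes _  = s≤s ih
  ... | yes py | no ¬qy = ⊥-elim (¬qy (P⊆Q py))
  ... | no _   | yes _  = ≤-trans ih (n≤1+n _)
  ... | no _   | no _   = ih

  filter-length-∪ : ∀ {r} {R : Pred A r} (R? : Decidable R) → R ⊆ P ∪ Q → ∀ xs →
                    length (filter R? xs) ≤ length (filter P? xs) + length (filter Q? xs)
  filter-length-∪ R? R⊆P∪Q []       = z≤n
  filter-length-∪ R? R⊆P∪Q (x ∷ xs) with ih ← filter-length-∪ R? R⊆P∪Q xs | R? x
  ... | no _ = ≤-trans ih (+-mono-≤ (filter-length-∷ P? xs) (filter-length-∷ Q? xs))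
  ... | yes rx with P? x
  ...   | yes _ = s≤s (≤-trans ih (+-monoʳ-≤ _ (filter-length-∷ Q? xs)))
  ...   | no ¬px with Q? x
  ...     | yes _  = ≤-trans (s≤s ih) (≤-reflexive (sym (+-suc _ _)))
  ...     | no ¬qx = ⊥-elim ([ ¬px , ¬qx ] (R⊆P∪Q rx))

module _ {a p r r′} {A : Set a} {P : Pred A p} {R : Rel A r} {R′ : Rel A r′} where

  allPairs-strengthen : (∀ {x y} → P x → P y → R x y → R′ x y) →
                        ∀ {xs} → All P xs → AllPairs R xs → AllPairs R′ xs
  allPairs-strengthen f []         []         = []
  allPairs-strengthen f (px ∷ pxs) (rx ∷ rxs) =
    All.map (λ (py , r) → f px py r) (All.zip (pxs , rx)) ∷ allPairs-strengthen f pxs rxs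

module _ {a r} {A : Set a} {R : Rel A r} (R-sym : Symmetric R) where

  allPairs-lookup : ∀ {xs} → AllPairs R xs → ∀ i j → i ≢ j → R (lookup xs i) (lookup xs j)
  allPairs-lookup (_ ∷ _)   zero    zero    i≢j = ⊥-elim (i≢j refl)
  allPairs-lookup (rx ∷ _)  zero    (suc j) _   = All.lookup rx (∈-lookup j)
  allPairs-lookup (rx ∷ _)  (suc i) zero    _   = R-sym (All.lookup rx (∈-lookup i))
  allPairs-lookup (_ ∷ rxs) (suc i) (suc j) i≢j = allPairs-lookup rxs i j (i≢j ∘ cong suc)

module _ {n : ℕ} where

  size : ∀ {p} {P : Pred (Fin n) p} → Decidable P → ℕ
  size P? = length (filter P? (allFin n))

  module _ {p q} {P : Pred (Fin n) p} {Q : Pred (Fin n) q} (P? : Decidable P) (Q? : Decidable Q) where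

    size-mono : P ⊆ Q → size P? ≤ size Q?
    size-mono P⊆Q = filter-length-mono P? Q? P⊆Q (allFin n)

    size-< : ∀ {x} → P ⊆ Q → Q x → ¬ P x → size P? < size Q?
    size-< {x} P⊆Q qx ¬px = filter-length-< P? Q? P⊆Q qx ¬px (∈-allFin x)

    size-∪ : ∀ {r} {R : Pred (Fin n) r} (R? : Decidable R) → R ⊆ P ∪ Q → size R? ≤ size P? + size Q?
    size-∪ R? R⊆P∪Q = filter-length-∪ P? Q? R? R⊆P∪Q (allFin n)

    size-<⇒∃ : size Q? < size P? → ∃ λ x → P x × ¬ Q x
    size-<⇒∃ Q<P with any? (P? ∩? ∁? Q?)
    ... | yes found = found
    ... | no none   = ⊥-elim (<⇒≱ Q<P (size-mono P⊆Q))
      where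
      P⊆Q : P ⊆ Q
      P⊆Q {x} px with Q? x
      ... | yes qx = qx
      ... | no ¬qx = ⊥-elim (none (x , px , ¬qx))

  size-pos⇒∃ : ∀ {p} {P : Pred (Fin n) p} (P? : Decidable P) → 0 < size P? → ∃ P
  size-pos⇒∃ P? pos with filter P? (allFin n) | all-filter P? (allFin n)
  size-pos⇒∃ P? () | []    | []
  size-pos⇒∃ P? _  | x ∷ _ | px ∷ _ = x , px

  size-induction : ∀ {ℓ} (P : ∀ {T : Pred (Fin n) 0ℓ} → Decidable T → Set ℓ) →
                   (∀ {T} (T? : Decidable T) →
                      (∀ {S} (S? : Decidable S) → size S? < size T? → P S?) → P T?) →
                   ∀ {T} (T? : Decidable T) → P T?
  size-induction P step T? =
    <-rec (λ s → ∀ {T} (T? : Decidable T) → size T? ≡ s → P T?)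
          (λ { _ ih T? refl → step T? λ S? S<T → ih S<T S? refl }) _ T? refl

no-surjection : ∀ {d c} → d < c → (g : Fin d → Fin c) → ¬ (∀ i → ∃ λ j → g j ≡ i)
no-surjection d<c g surj with pigeonhole d<c (proj₁ ∘ surj)
... | i , j , i<j , same = <⇒≢ᶠ i<j (trans (sym (proj₂ (surj i))) (trans (cong g same) (proj₂ (surj j))))

unused-value : ∀ {d c} (g : Fin d → Fin c) → d < c → ∃ λ i → ∀ j → g j ≢ i
unused-value g d<c with ¬∀⟶∃¬ _ _ (λ i → any? (λ j → g j ≟ᶠ i)) (no-surjection d<c g)
... | i , missed = i , λ j gj≡i → missed (j , gj≡i)

join-injective : ∀ {a b} {x y : Fin a ⊎ Fin b} → join a b x ≡ join a b y → x ≡ y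
join-injective {a} {b} {x} {y} same =
  trans (sym (splitAt-join a b x)) (trans (cong (splitAt a) same) (splitAt-join a b y))

square-suc : ∀ k → k * k + suc (k + k) ≡ suc k * suc k
square-suc = solve-∀

Twins : ∀ {k} → Graph k → Fin k → Fin k → Set
Twins H i j = ∀ l → adj H i l ≡ adj H j l

twins? : ∀ {k} (H : Graph k) i j → Dec (Twins H i j)
twins? H i j = all? (λ l → adj H i l ≟ᵇ adj H j l)

fork-twins : ∀ i j → i ≢ j → Twins fork i j → (i ≡ 1F × j ≡ 2F) ⊎ (i ≡ 2F × j ≡ 1F)
fork-twins = from-yes (all? λ i → all? λ j →
  ¬? (i ≟ᶠ j) →-dec twins? fork i j →-dec
    ((i ≟ᶠ 1F ×-dec j ≟ᶠ 2F) ⊎-dec (i ≟ᶠ 2F ×-dec j ≟ᶠ 1F)))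

cocricket-twins : ∀ i j → i ≢ j → Twins cocricket i j → (i ≡ 2F × j ≡ 3F) ⊎ (i ≡ 3F × j ≡ 2F)
cocricket-twins = from-yes (all? λ i → all? λ j →
  ¬? (i ≟ᶠ j) →-dec twins? cocricket i j →-dec
    ((i ≟ᶠ 2F ×-dec j ≟ᶠ 3F) ⊎-dec (i ≟ᶠ 3F ×-dec j ≟ᶠ 2F)))

module _ {n : ℕ} (G : Graph n) where

  infix 4 _~_
  _~_ : Rel (Fin n) 0ℓ
  u ~ v = adj G u v ≡ true

  _~?_ : ∀ u v → Dec (u ~ v)
  u ~? v = adj G u v ≟ᵇ true

  ~-sym : ∀ {u v} → u ~ v → v ~ u
  ~-sym {u} {v} = trans (adj-sym G v u)

  ≁-sym : ∀ {u v} → ¬ u ~ v → ¬ v ~ u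
  ≁-sym u≁v = u≁v ∘ ~-sym

  ~-irrefl : ∀ {v} → ¬ v ~ v
  ~-irrefl {v} v~v with trans (sym v~v) (adj-irrefl G v)
  ... | ()

  ~⇒≢ : ∀ {u v} → u ~ v → u ≢ v
  ~⇒≢ u~v refl = ~-irrefl u~v

  induced : ∀ {k} (H : Graph k) (f : Fin k → Fin n) →
            (∀ i j → adj G (f i) (f j) ≡ adj H i j) →
            (∀ i j → i ≢ j → Twins H i j → f i ≢ f j) → InducedSub H G
  induced H f preserves separates = f , injective , preserves
    where
    injective : ∀ {i j} → f i ≡ f j → i ≡ j
    injective {i} {j} fi≡fj with i ≟ᶠ j
    ... | yes i≡j = i≡j
    ... | no i≢j  = ⊥-elim (separates i j i≢j twins fi≡fj)
      where
      twins : Twins H i j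
      twins l = trans (sym (preserves i l)) (trans (cong (λ x → adj G x (f l)) fi≡fj) (preserves j l))

  no-fork : (fork -free) G → ∀ {c a b d e} → a ≢ b →
            c ~ a → c ~ b → c ~ d → d ~ e →
            ¬ a ~ b → ¬ a ~ d → ¬ b ~ d → ¬ c ~ e → ¬ a ~ e → ¬ b ~ e → ⊥
  no-fork forkFree {c} {a} {b} {d} {e} a≢b c~a c~b c~d d~e a≁b a≁d b≁d c≁e a≁e b≁e =
    forkFree (induced fork f preserves separates)
    where
    f : Fin 5 → Fin n
    f 0F = c
    f 1F = a
    f 2F = b
    f 3F = e
    f 4F = d
    preserves : ∀ i j → adj G (f i) (f j) ≡ forkAdj i j
    preserves 0F 0F = adj-irrefl G c
    preserves 0F 1F = c~a
    preserves 0F 2F = c~b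
    preserves 0F 3F = ¬-not c≁e
    preserves 0F 4F = c~d
    preserves 1F 0F = ~-sym c~a
    preserves 1F 1F = adj-irrefl G a
    preserves 1F 2F = ¬-not a≁b
    preserves 1F 3F = ¬-not a≁e
    preserves 1F 4F = ¬-not a≁d
    preserves 2F 0F = ~-sym c~b
    preserves 2F 1F = ¬-not (≁-sym a≁b)
    preserves 2F 2F = adj-irrefl G b
    preserves 2F 3F = ¬-not b≁e
    preserves 2F 4F = ¬-not b≁d
    preserves 3F 0F = ¬-not (≁-sym c≁e)
    preserves 3F 1F = ¬-not (≁-sym a≁e)
    preserves 3F 2F = ¬-not (≁-sym b≁e)
    preserves 3F 3F = adj-irrefl G e
    preserves 3F 4F = ~-sym d~e
    preserves 4F 0F = ~-sym c~d
    preserves 4F 1F = ¬-not (≁-sym a≁d)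
    preserves 4F 2F = ¬-not (≁-sym b≁d)
    preserves 4F 3F = d~e
    preserves 4F 4F = adj-irrefl G d
    separates : ∀ i j → i ≢ j → Twins fork i j → f i ≢ f j
    separates i j i≢j twins with fork-twins i j i≢j twins
    ... | inj₁ (refl , refl) = a≢b
    ... | inj₂ (refl , refl) = ≢-sym a≢b

  no-cocricket : (cocricket -free) G → ∀ {a b x y z} → x ≢ y →
                 a ~ b → a ~ x → a ~ y → b ~ x → b ~ y → ¬ x ~ y →
                 ¬ a ~ z → ¬ b ~ z → ¬ x ~ z → ¬ y ~ z → ⊥
  no-cocricket cocricketFree {a} {b} {x} {y} {z} x≢y a~b a~x a~y b~x b~y x≁y a≁z b≁z x≁z y≁z =
    cocricketFree (induced cocricket f preserves separates)
    where
    f : Fin 5 → Fin n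
    f 0F = a
    f 1F = b
    f 2F = x
    f 3F = y
    f 4F = z
    preserves : ∀ i j → adj G (f i) (f j) ≡ cocricketAdj i j
    preserves 0F 0F = adj-irrefl G a
    preserves 0F 1F = a~b
    preserves 0F 2F = a~x
    preserves 0F 3F = a~y
    preserves 0F 4F = ¬-not a≁z
    preserves 1F 0F = ~-sym a~b
    preserves 1F 1F = adj-irrefl G b
    preserves 1F 2F = b~x
    preserves 1F 3F = b~y
    preserves 1F 4F = ¬-not b≁z
    preserves 2F 0F = ~-sym a~x
    preserves 2F 1F = ~-sym b~x
    preserves 2F 2F = adj-irrefl G x
    preserves 2F 3F = ¬-not x≁y
    preserves 2F 4F = ¬-not x≁z
    preserves 3F 0F = ~-sym a~y
    preserves 3F 1F = ~-sym b~y
    preserves 3F 2F = ¬-not (≁-sym x≁y)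
    preserves 3F 3F = adj-irrefl G y
    preserves 3F 4F = ¬-not y≁z
    preserves 4F 0F = ¬-not (≁-sym a≁z)
    preserves 4F 1F = ¬-not (≁-sym b≁z)
    preserves 4F 2F = ¬-not (≁-sym x≁z)
    preserves 4F 3F = ¬-not (≁-sym y≁z)
    preserves 4F 4F = adj-irrefl G z
    separates : ∀ i j → i ≢ j → Twins cocricket i j → f i ≢ f j
    separates i j i≢j twins with cocricket-twins i j i≢j twins
    ... | inj₁ (refl , refl) = x≢y
    ... | inj₂ (refl , refl) = ≢-sym x≢y

  private variable
    S T R : Pred (Fin n) 0ℓ
    u v w : Fin n
    c d k : ℕ

  DiamondFreeOn : Pred (Fin n) 0ℓ → Set
  DiamondFreeOn T = ∀ {a b x y} → T a → T b → T x → T y → x ≢ y →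
                    a ~ b → a ~ x → a ~ y → b ~ x → b ~ y → ¬ x ~ y → ⊥

  TriangleFreeOn : Pred (Fin n) 0ℓ → Set
  TriangleFreeOn T = ∀ {a b c} → T a → T b → T c → a ~ b → a ~ c → b ~ c → ⊥

  diamondFree-mono : S ⊆ T → DiamondFreeOn T → DiamondFreeOn S
  diamondFree-mono S⊆T diamondFree sa sb sx sy = diamondFree (S⊆T sa) (S⊆T sb) (S⊆T sx) (S⊆T sy)

  nonNeighbours-diamondFree : (cocricket -free) G → ∀ v → DiamondFreeOn (∁ (v ~_))
  nonNeighbours-diamondFree cocricketFree v v≁a v≁b v≁x v≁y x≢y a~b a~x a~y b~x b~y x≁y =
    no-cocricket cocricketFree x≢y a~b a~x a~y b~x b~y x≁y
      (≁-sym v≁a) (≁-sym v≁b) (≁-sym v≁x) (≁-sym v≁y)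

  CliqueBound : Pred (Fin n) 0ℓ → ℕ → Set
  CliqueBound T k = ∀ xs → All T xs → AllPairs _~_ xs → length xs ≤ k

  cliqueBound-mono : S ⊆ T → CliqueBound T k → CliqueBound S k
  cliqueBound-mono S⊆T bound xs Sxs = bound xs (All.map S⊆T Sxs)

  cliqueBound-neighbours : T v → CliqueBound T (suc k) → CliqueBound (T ∩ (v ~_)) k
  cliqueBound-neighbours {v = v} tv bound xs Nxs clique =
    ≤-pred (bound (v ∷ xs) (tv ∷ All.map proj₁ Nxs) (All.map proj₂ Nxs ∷ clique))

  cliqueBound-size : CliqueBound T k → (S? : Decidable S) → S ⊆ T →
                     (∀ {x y} → S x → S y → x ≢ y → x ~ y) → size S? ≤ k
  cliqueBound-size bound S? S⊆T adjacent =
    bound _ (All.map S⊆T Sxs) (allPairs-strengthen adjacent Sxs (AllPairsₚ.filter⁺ S? (allFin⁺ n)))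
    where
    Sxs = all-filter S? (allFin n)

  Colourable : Pred (Fin n) 0ℓ → ℕ → Set
  Colourable T c = ∃ λ (col : Fin n → Fin c) → ∀ {u w} → T u → T w → u ~ w → col u ≢ col w

  colourable-≤ : c ≤ d → Colourable T c → Colourable T d
  colourable-≤ c≤d (col , proper) =
    (λ w → inject≤ (col w) c≤d) , λ tu tw u~w → proper tu tw u~w ∘ inject≤-injective c≤d c≤d _ _

  colourable-empty : (∀ v → ¬ T v) → Colourable T (suc c)
  colourable-empty empty = (λ _ → zero) , λ tu _ _ _ → empty _ tu

  colourable-split : ∀ {a b} {P : Pred (Fin n) 0ℓ} (P? : Decidable P) →
                     Colourable (T ∩ P) a → Colourable (T ∩ ∁ P) b → Colourable T (a + b)
  colourable-split {T = T} {a} {b} P? (col₁ , proper₁) (col₂ , proper₂) =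
    join a b ∘ col , λ tu tw u~w → distinct tu tw u~w ∘ join-injective
    where
    col : Fin n → Fin a ⊎ Fin b
    col w with P? w
    ... | yes _ = inj₁ (col₁ w)
    ... | no _  = inj₂ (col₂ w)
    distinct : T u → T w → u ~ w → col u ≢ col w
    distinct {u} {w} tu tw u~w with P? u | P? w
    ... | yes pu  | yes pw  = proper₁ (tu , pu) (tw , pw) u~w ∘ inj₁-injective
    ... | no ¬pu  | no ¬pw  = proper₂ (tu , ¬pu) (tw , ¬pw) u~w ∘ inj₂-injective
    ... | yes _   | no _    = λ ()
    ... | no _    | yes _   = λ ()

  colourable-closed-union : (R? : Decidable R) → (∀ {u w} → T w → R u → u ~ w → R w) →
                            Colourable (T ∩ R) c → Colourable (T ∩ ∁ R) c → Colourable T c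
  colourable-closed-union {R = R} {T = T} {c = c} R? closed (col₁ , proper₁) (col₂ , proper₂) = col , proper
    where
    col : Fin n → Fin c
    col w with R? w
    ... | yes _ = col₁ w
    ... | no _  = col₂ w
    proper : T u → T w → u ~ w → col u ≢ col w
    proper {u} {w} tu tw u~w with R? u | R? w
    ... | yes ru  | yes rw  = proper₁ (tu , ru) (tw , rw) u~w
    ... | no ¬ru  | no ¬rw  = proper₂ (tu , ¬ru) (tw , ¬rw) u~w
    ... | yes ru  | no ¬rw  = ⊥-elim (¬rw (closed tw ru u~w))
    ... | no ¬ru  | yes rw  = ⊥-elim (¬ru (closed tu rw (~-sym u~w)))

  degree : Decidable T → Fin n → ℕ
  degree T? u = size (T? ∩? (u ~?_))

  colourable-insert : (T? : Decidable T) → T u → degree T? u < c →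
                      Colourable (T ∩ (_≢ u)) c → Colourable T c
  colourable-insert {T = T} {u = u} {c = c} T? tu deg<c (col , proper) = col′ , proper′
    where
    neighbours = filter (T? ∩? (u ~?_)) (allFin n)
    free = unused-value (col ∘ lookup neighbours) deg<c
    col′ : Fin n → Fin c
    col′ w with u ≟ᶠ w
    ... | yes _ = proj₁ free
    ... | no _  = col w
    neighbour-not-free : T w → u ~ w → col w ≢ proj₁ free
    neighbour-not-free {w} tw u~w =
      proj₂ free (index w∈) ∘ trans (cong col (sym (lookup-index w∈)))
      where
      w∈ : w ∈ neighbours
      w∈ = ∈-filter⁺ (T? ∩? (u ~?_)) (∈-allFin w) (tw , u~w)
    proper′ : T v → T w → v ~ w → col′ v ≢ col′ w
    proper′ {v} {w} tv tw v~w with u ≟ᶠ v | u ≟ᶠ w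
    ... | yes refl | yes refl = ⊥-elim (~-irrefl v~w)
    ... | yes refl | no _     = neighbour-not-free tw v~w ∘ sym
    ... | no _     | yes refl = neighbour-not-free tv (~-sym v~w)
    ... | no u≢v   | no u≢w   = proper (tv , ≢-sym u≢v) (tw , ≢-sym u≢w) v~w

  Close : Rel (Fin n) 0ℓ
  Close x y = x ≡ y ⊎ x ~ y

  close? : ∀ x y → Dec (Close x y)
  close? x y = (x ≟ᶠ y) ⊎-dec (x ~? y)

  close-sym : ∀ {x y} → Close x y → Close y x
  close-sym (inj₁ refl) = inj₁ refl
  close-sym (inj₂ x~y)  = inj₂ (~-sym x~y)

  close⇒~ : ∀ {x y} → Close x y → x ≢ y → x ~ y
  close⇒~ (inj₁ x≡y) x≢y = ⊥-elim (x≢y x≡y)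
  close⇒~ (inj₂ x~y) _   = x~y

  module DiamondFreeNeighbourhoods {T : Pred (Fin n) 0ℓ} (T? : Decidable T) (diamondFree : DiamondFreeOn T) where

    N : Fin n → Pred (Fin n) 0ℓ
    N a = T ∩ (a ~_)

    N? : ∀ a → Decidable (N a)
    N? a = T? ∩? (a ~?_)

    -- Diamond-freeness makes Close an equivalence relation on each neighbourhood, with cliques as classes.
    close-trans : ∀ {a x y z} → T a → N a x → N a y → N a z → Close x y → Close y z → Close x z
    close-trans _ _ _ _ (inj₁ refl) y≈z = y≈z
    close-trans _ _ _ _ x≈y (inj₁ refl) = x≈y
    close-trans {x = x} {z = z} ta (tx , a~x) (ty , a~y) (tz , a~z) (inj₂ x~y) (inj₂ y~z) with close? x z
    ... | yes x≈z = x≈z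
    ... | no x≉z  = ⊥-elim (diamondFree ta ty tx tz (x≉z ∘ inj₁) a~y a~x a~z (~-sym x~y) y~z (x≉z ∘ inj₂))

    apart-transfer : ∀ {a b x y} → T a → N a b → N a x → N a y → Close b x → ¬ Close x y → ¬ Close b y
    apart-transfer ta nb nx ny b≈x x≉y b≈y = x≉y (close-trans ta nx nb ny (close-sym b≈x) b≈y)

    module _ {m} (bound : CliqueBound T (suc m)) where

      class-size : ∀ {a p} → T a → N a p → size (N? a ∩? close? p) ≤ m
      class-size ta np = cliqueBound-size (cliqueBound-neighbours ta bound) (N? _ ∩? close? _) proj₁
        λ (nx , p≈x) (ny , p≈y) x≢y → close⇒~ (close-trans ta nx np ny (close-sym p≈x) p≈y) x≢y

      two-classes-size : ∀ {a p q} → T a → N a p → N a q → size (N? a ∩? (close? p ∪? close? q)) ≤ m + m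
      two-classes-size ta np nq =
        ≤-trans (size-∪ (N? _ ∩? close? _) (N? _ ∩? close? _) _ λ (nx , close-p-or-q) →
                   Sum.map (nx ,_) (nx ,_) close-p-or-q)
                (+-mono-≤ (class-size ta np) (class-size ta nq))

      apart-neighbour : ∀ {a p} → T a → m < degree T? a → N a p → ∃ λ q → N a q × ¬ Close p q
      apart-neighbour ta m<deg np with size-<⇒∃ (N? _) (N? _ ∩? close? _) (≤-<-trans (class-size ta np) m<deg)
      ... | q , nq , ¬p≈q = q , nq , λ p≈q → ¬p≈q (nq , p≈q)

      record ApartTriple (a : Fin n) : Set where
        field
          p q r : Fin n
          p∈N : N a p
          q∈N : N a q
          r∈N : N a r
          p≉q : ¬ Close p q
          p≉r : ¬ Close p r
          q≉r : ¬ Close q r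

      apart-triple : ∀ {a} → T a → m + m < degree T? a → ApartTriple a
      apart-triple {a} ta 2m<deg with size-pos⇒∃ (N? a) (≤-<-trans z≤n 2m<deg)
      ... | p , np with apart-neighbour ta (≤-<-trans (m≤m+n m m) 2m<deg) np
      ... | q , nq , p≉q
        with size-<⇒∃ (N? a) (N? a ∩? (close? p ∪? close? q)) (≤-<-trans (two-classes-size ta np nq) 2m<deg)
      ... | r , nr , ¬p≈r⊎q≈r = record
        { p∈N = np ; q∈N = nq ; r∈N = nr ; p≉q = p≉q
        ; p≉r = λ p≈r → ¬p≈r⊎q≈r (nr , inj₁ p≈r)
        ; q≉r = λ q≈r → ¬p≈r⊎q≈r (nr , inj₂ q≈r) }

      ApartPair : Fin n → Fin n → Set
      ApartPair a b = ∃₂ λ r s → N a r × N a s × ¬ Close r s × ¬ Close b r × ¬ Close b s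

      module _ {a} (ta : T a) (t : ApartTriple a) where
        open ApartTriple t

        apart-pair : ∀ {b} → N a b → ApartPair a b
        apart-pair {b} nb with close? b p | close? b q
        ... | yes b≈p | _       = q , r , q∈N , r∈N , q≉r , apart-transfer ta nb p∈N q∈N b≈p p≉q
                                                          , apart-transfer ta nb p∈N r∈N b≈p p≉r
        ... | no b≉p  | yes b≈q = p , r , p∈N , r∈N , p≉r , b≉p , apart-transfer ta nb q∈N r∈N b≈q q≉r
        ... | no b≉p  | no b≉q  = p , q , p∈N , q∈N , p≉q , b≉p , b≉q

      -- r and s are apart from each other and from b and c, y is a neighbour of b apart from a;
      -- each adjacency pattern between y and c, r, s yields a diamond or a fork.
      triangle-free : (fork -free) G → (∀ {u} → T u → m + m < degree T? u) → TriangleFreeOn T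
      triangle-free forkFree high {a} {b} {c} ta tb tc a~b a~c b~c =
        contradict (apart-pair ta (apart-triple ta (high ta)) (tb , a~b))
                   (apart-neighbour tb (≤-<-trans (m≤m+n m m) (high tb)) (ta , ~-sym a~b))
        where
        c≉ : ∀ {x} → N a x → ¬ Close b x → ¬ Close c x
        c≉ nx = apart-transfer ta (tc , a~c) (tb , a~b) nx (inj₂ (~-sym b~c))
        contradict : ApartPair a b → (∃ λ y → N b y × ¬ Close a y) → ⊥
        contradict (r , s , nr@(_ , a~r) , ns@(_ , a~s) , r≉s , b≉r , b≉s) (y , (ty , b~y) , a≉y)
          with c≉ nr b≉r | c≉ ns b≉s | c ~? y | y ~? r | y ~? s
        ... | _   | _   | yes c~y | _       | _       =
          diamondFree tb tc ta ty (a≉y ∘ inj₁) b~c (~-sym a~b) b~y (~-sym a~c) c~y (a≉y ∘ inj₂)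
        ... | _   | _   | no _    | no y≁r  | no y≁s  =
          no-fork forkFree (r≉s ∘ inj₁) a~r a~s a~b b~y
            (r≉s ∘ inj₂) (≁-sym (b≉r ∘ inj₂)) (≁-sym (b≉s ∘ inj₂))
            (a≉y ∘ inj₂) (≁-sym y≁r) (≁-sym y≁s)
        ... | c≉r | c≉s | no c≁y  | yes y~r | yes y~s =
          no-fork forkFree (r≉s ∘ inj₁) y~r y~s (~-sym b~y) b~c
            (r≉s ∘ inj₂) (≁-sym (b≉r ∘ inj₂)) (≁-sym (b≉s ∘ inj₂))
            (≁-sym c≁y) (≁-sym (c≉r ∘ inj₂)) (≁-sym (c≉s ∘ inj₂))
        ... | c≉r | c≉s | no c≁y  | yes y~r | no y≁s  =
          no-fork forkFree (c≉s ∘ inj₁) a~c a~s a~r (~-sym y~r)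
            (c≉s ∘ inj₂) (c≉r ∘ inj₂) (≁-sym (r≉s ∘ inj₂)) (a≉y ∘ inj₂) c≁y (≁-sym y≁s)
        ... | c≉r | c≉s | no c≁y  | no y≁r  | yes y~s =
          no-fork forkFree (c≉r ∘ inj₁) a~c a~r a~s (~-sym y~s)
            (c≉r ∘ inj₂) (c≉s ∘ inj₂) (r≉s ∘ inj₂) (a≉y ∘ inj₂) c≁y (≁-sym y≁r)

  module Bipartition (forkFree : (fork -free) G) {T : Pred (Fin n) 0ℓ} (T? : Decidable T)
                     (triangleFree : TriangleFreeOn T) {v p q r : Fin n} (tv : T v)
                     (np : (T ∩ (v ~_)) p) (nq : (T ∩ (v ~_)) q) (nr : (T ∩ (v ~_)) r)
                     (p≢q : p ≢ q) (p≢r : p ≢ r) (q≢r : q ≢ r) where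

    N₁ : Pred (Fin n) 0ℓ
    N₁ = T ∩ (v ~_)

    -- Even holds for v itself and the vertices at distance 2 from v, Odd for their neighbours.
    Even : Pred (Fin n) 0ℓ
    Even w = T w × ¬ v ~ w × ∃ λ a → N₁ a × a ~ w

    Odd : Pred (Fin n) 0ℓ
    Odd w = T w × ∃ λ x → Even x × x ~ w

    even? : Decidable Even
    even? w = T? w ×-dec ¬? (v ~? w) ×-dec any? λ a → (T? a ×-dec v ~? a) ×-dec a ~? w

    odd? : Decidable Odd
    odd? w = T? w ×-dec any? λ x → even? x ×-dec x ~? w

    N₁-independent : ∀ {b c} → N₁ b → N₁ c → ¬ b ~ c
    N₁-independent (tb , v~b) (tc , v~c) = triangleFree tv tb tc v~b v~c

    even-misses-at-most-one : ∀ {x b c} → Even x → N₁ b → N₁ c → b ≢ c → ¬ x ~ b → ¬ x ~ c → ⊥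
    even-misses-at-most-one (_ , v≁x , a , na , a~x) nb nc b≢c x≁b x≁c =
      no-fork forkFree b≢c (proj₂ nb) (proj₂ nc) (proj₂ na) a~x
        (N₁-independent nb nc) (N₁-independent nb na) (N₁-independent nc na) v≁x (≁-sym x≁b) (≁-sym x≁c)

    even-two-neighbours : ∀ {x} → Even x → ∃₂ λ b c → N₁ b × N₁ c × b ≢ c × x ~ b × x ~ c
    even-two-neighbours {x} ex with x ~? p | x ~? q | x ~? r
    ... | yes x~p | yes x~q | _       = p , q , np , nq , p≢q , x~p , x~q
    ... | yes x~p | no _    | yes x~r = p , r , np , nr , p≢r , x~p , x~r
    ... | no _    | yes x~q | yes x~r = q , r , nq , nr , q≢r , x~q , x~r
    ... | yes _   | no x≁q  | no x≁r  = ⊥-elim (even-misses-at-most-one ex nq nr q≢r x≁q x≁r)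
    ... | no x≁p  | yes _   | no x≁r  = ⊥-elim (even-misses-at-most-one ex np nr p≢r x≁p x≁r)
    ... | no x≁p  | no x≁q  | _       = ⊥-elim (even-misses-at-most-one ex np nq p≢q x≁p x≁q)

    even-independent : ∀ {x y} → Even x → Even y → ¬ x ~ y
    even-independent ex@(tx , _) ey@(ty , _) x~y with even-two-neighbours ex
    ... | b , c , nb , nc , b≢c , x~b , x~c with _ ~? b | _ ~? c
    ...   | yes y~b | _       = triangleFree tx ty (proj₁ nb) x~y x~b y~b
    ...   | no _    | yes y~c = triangleFree tx ty (proj₁ nc) x~y x~c y~c
    ...   | no y≁b  | no y≁c  = even-misses-at-most-one ey nb nc b≢c y≁b y≁c

    odd-neighbour-even : ∀ {z w} → Odd z → T w → z ~ w → Even w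
    odd-neighbour-even (tz , x , ex@(tx , _) , x~z) tw z~w with even-two-neighbours ex
    ... | b , c , nb@(tb , v~b) , nc@(tc , v~c) , b≢c , x~b , x~c with b ~? _ | c ~? _
    ...   | yes b~w | _       = tw , triangleFree tb tv tw (~-sym v~b) b~w , b , nb , b~w
    ...   | no _    | yes c~w = tw , triangleFree tc tv tw (~-sym v~c) c~w , c , nc , c~w
    ...   | no b≁w  | no c≁w  = ⊥-elim (no-fork forkFree b≢c x~b x~c x~z z~w
        (N₁-independent nb nc) (triangleFree tx tb tz x~b x~z) (triangleFree tx tc tz x~c x~z)
        (triangleFree tz tx tw (~-sym x~z) z~w) b≁w c≁w)

    odd-independent : ∀ {z w} → Odd z → Odd w → ¬ z ~ w
    odd-independent oz (tw , x , ex , x~w) z~w = even-independent ex (odd-neighbour-even oz tw z~w) x~w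

    Ball : Pred (Fin n) 0ℓ
    Ball = Even ∪ Odd

    ball? : Decidable Ball
    ball? = even? ∪? odd?

    v∈Ball : Ball v
    v∈Ball = inj₁ (tv , ~-irrefl , _ , np , ~-sym (proj₂ np))

    ball-closed : ∀ {u w} → T w → Ball u → u ~ w → Ball w
    ball-closed tw (inj₁ eu) u~w = inj₂ (tw , _ , eu , u~w)
    ball-closed tw (inj₂ ou) u~w = inj₁ (odd-neighbour-even ou tw u~w)

    ball-2-colourable : Colourable (T ∩ Ball) 2
    ball-2-colourable = col , proper
      where
      col : Fin n → Fin 2
      col w with even? w
      ... | yes _ = 0F
      ... | no _  = 1F
      odd : ∀ {w} → Ball w → ¬ Even w → Odd w
      odd (inj₁ ew) ¬ew = ⊥-elim (¬ew ew)
      odd (inj₂ ow) _   = ow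
      proper : ∀ {u w} → (T ∩ Ball) u → (T ∩ Ball) w → u ~ w → col u ≢ col w
      proper {u} {w} (_ , bu) (_ , bw) u~w with even? u | even? w
      ... | yes eu  | yes ew  = λ _ → even-independent eu ew u~w
      ... | no ¬eu  | no ¬ew  = λ _ → odd-independent (odd bu ¬eu) (odd bw ¬ew) u~w
      ... | yes _   | no _    = λ ()
      ... | no _    | yes _   = λ ()

  high-degree-ball : (fork -free) G → ∀ {m T v} (T? : Decidable T) → DiamondFreeOn T → CliqueBound T (suc m) →
                     (∀ {u} → T u → m + m < degree T? u) → T v →
                     ∃ λ (R : Pred (Fin n) 0ℓ) → Decidable R × R v ×
                       (∀ {u w} → T w → R u → u ~ w → R w) × Colourable (T ∩ R) (suc (m + m))
  high-degree-ball forkFree {m} T? diamondFree bound high tv =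
    Ball , ball? , v∈Ball , ball-closed , colourable-≤ 2≤1+m+m ball-2-colourable
    where
    open DiamondFreeNeighbourhoods T? diamondFree
    open ApartTriple (apart-triple bound tv (high tv))
    open Bipartition forkFree T? (triangle-free bound forkFree high) tv p∈N q∈N r∈N
                     (p≉q ∘ inj₁) (p≉r ∘ inj₁) (q≉r ∘ inj₁)
    2≤1+m+m : 2 ≤ suc (m + m)
    2≤1+m+m = s≤s (≤-trans (cliqueBound-neighbours tv bound (p ∷ []) (p∈N ∷ []) ([] ∷ [])) (m≤m+n m m))

  diamondFree-colourable : (fork -free) G → ∀ m {T} (T? : Decidable T) →
                           DiamondFreeOn T → CliqueBound T (suc m) → Colourable T (suc (m + m))
  diamondFree-colourable forkFree m = size-induction (λ {T} _ → Goal T) step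
    where
    Goal : Pred (Fin n) 0ℓ → Set
    Goal T = DiamondFreeOn T → CliqueBound T (suc m) → Colourable T (suc (m + m))
    step : ∀ {T} (T? : Decidable T) → (∀ {S} (S? : Decidable S) → size S? < size T? → Goal S) → Goal T
    step {T} T? ih diamondFree bound = by-degree (any? λ u → T? u ×-dec degree T? u ≤? m + m)
      where
      colour-without : ∀ {P x} (P? : Decidable P) → T x → ¬ P x → Colourable (T ∩ P) (suc (m + m))
      colour-without P? tx ¬px = ih (T? ∩? P?) (size-< (T? ∩? P?) T? proj₁ tx (¬px ∘ proj₂))
                                    (diamondFree-mono proj₁ diamondFree) (cliqueBound-mono proj₁ bound)
      by-degree : Dec (∃ λ u → T u × degree T? u ≤ m + m) → Colourable T (suc (m + m))
      by-degree (yes (u , tu , low)) =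
        colourable-insert T? tu (s≤s low) (colour-without (∁? (_≟ᶠ u)) tu (λ u≢u → u≢u refl))
      by-degree (no no-low) = by-emptiness (any? T?)
        where
        high : ∀ {u} → T u → m + m < degree T? u
        high tu = ≰⇒> λ low → no-low (_ , tu , low)
        by-emptiness : Dec (∃ T) → Colourable T (suc (m + m))
        by-emptiness (no empty)     = colourable-empty λ v tv → empty (v , tv)
        by-emptiness (yes (v , tv)) =
          let R , R? , v∈R , closed , colourable-R = high-degree-ball forkFree T? diamondFree bound high tv
          in  colourable-closed-union R? closed colourable-R (colour-without (∁? R?) tv (λ v∉R → v∉R v∈R))

  colourable-square : (fork -free) G → (cocricket -free) G → ∀ m {S} (S? : Decidable S) →
                      CliqueBound S (suc m) → Colourable S (suc m * suc m)
  colourable-square _ _ zero S? bound =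
    (λ _ → zero) , λ su sw u~w _ →
      <-irrefl refl (bound (_ ∷ _ ∷ []) (su ∷ sw ∷ []) ((u~w ∷ []) ∷ [] ∷ []))
  colourable-square forkFree cocricketFree (suc m) {S} S? bound with any? S?
  ... | no empty    = colourable-empty λ v sv → empty (v , sv)
  ... | yes (v , sv) = subst (Colourable S) (square-suc (suc m)) (colourable-split (v ~?_) neighbours non-neighbours)
    where
    neighbours : Colourable (S ∩ (v ~_)) (suc m * suc m)
    neighbours = colourable-square forkFree cocricketFree m (S? ∩? (v ~?_)) (cliqueBound-neighbours sv bound)
    non-neighbours : Colourable (S ∩ ∁ (v ~_)) (suc (suc m + suc m))
    non-neighbours = diamondFree-colourable forkFree (suc m) (S? ∩? ∁? (v ~?_))
                       (diamondFree-mono proj₂ (nonNeighbours-diamondFree cocricketFree v))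
                       (cliqueBound-mono proj₁ bound)

  cliqueBound-from-HasClique : ∀ {ω} → (∀ k → HasClique G k → k ≤ ω) → CliqueBound U ω
  cliqueBound-from-HasClique bound xs _ clique = bound (length xs) (lookup xs , injective , adjacent)
    where
    adjacent : ∀ i j → i ≢ j → lookup xs i ~ lookup xs j
    adjacent = allPairs-lookup ~-sym clique
    injective : ∀ {i j} → lookup xs i ≡ lookup xs j → i ≡ j
    injective {i} {j} same with i ≟ᶠ j
    ... | yes i≡j = i≡j
    ... | no i≢j  = ⊥-elim (~⇒≢ (adjacent i j i≢j) same)

  properColouring-square : (fork -free) G → (cocricket -free) G → ∀ ω → CliqueBound U ω →
                           ProperColouring G (ω * ω)
  properColouring-square _ _ zero bound = (λ v → ⊥-elim (no-vertex v)) , λ u → ⊥-elim (no-vertex u)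
    where
    no-vertex : Fin n → ⊥
    no-vertex v with bound (v ∷ []) (_ ∷ []) ([] ∷ [])
    ... | ()
  properColouring-square forkFree cocricketFree (suc m) bound
    with col , proper ← colourable-square forkFree cocricketFree m U? bound =
    col , λ u w u~w → proper _ _ u~w

mainTheorem10 : ∀ (n : ℕ) (G : Graph n) (ω χ : ℕ) →
    (fork -free) G → (cocricket -free) G →
    IsCliqueNumber G ω → IsChromaticNumber G χ →
    χ ≤ ω * ω
mainTheorem10 n G ω χ forkFree cocricketFree (_ , maximal) (_ , minimal) =
  minimal (ω * ω) (properColouring-square G forkFree cocricketFree ω (cliqueBound-from-HasClique G maximal))
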